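{- Let $G$ and $H$ be connected graphs of order at least $3$, and let $D$ be a minimal dominating set of $G$. The set $D \times V(H)$ is a minimal dominating set of $G \times H$ if and only if $D$ is independent in $G$.
   Context: All graphs are finite, simple and undirected. A dominating set of $X$ is a set $D$ of vertices such that every vertex is in $D$ or adjacent to a vertex of $D$; it is minimal if no proper subset is dominating. The direct product $G\times H$ has vertex set $V(G)\times V(H)$, with $(g_1,h_1)\sim(g_2,h_2)$ iff $g_1g_2\in E(G)$ and $h_1h_2\in E(H)$. -}

module Defs where

open import Data.Nat using (ℕ; suc; _≥_)
open import Data.Fin using (Fin)
open import Data.Product using (_×_; _,_; Σ; ∃; ∃-syntax; proj₁; proj₂)
open import Data.Sum using (_⊎_)
open import Data.Empty using (⊥)
open import Relation.Nullary using (¬_; Dec)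
open import Relation.Binary.PropositionalEquality using (_≡_)
open import Function.Bundles using (_↔_)

record Graph : Set₁ where
  field
    V      : Set
    order  : ℕ
    enum   : V ↔ Fin order
    Adj    : V → V → Set
    Adj?   : (x y : V) → Dec (Adj x y)
    sym    : ∀ {x y} → Adj x y → Adj y x
    irrefl : ∀ {x} → ¬ Adj x x
open Graph public

VSet : Graph → Set₁
VSet G = V G → Set

data Walk (G : Graph) : V G → V G → Set where
  here : ∀ {x} → Walk G x x
  step : ∀ {x y z} → Adj G x y → Walk G y z → Walk G x z

Connected : Graph → Set
Connected G = ∀ (x y : V G) → Walk G x y

Dominating : (G : Graph) → VSet G → Set
Dominating G D = ∀ (x : V G) → D x ⊎ (∃[ y ] (D y × Adj G x y))

_⊆_ : {G : Graph} → VSet G → VSet G → Set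
_⊆_ {G} S D = ∀ {x : V G} → S x → D x

_⊂_ : {G : Graph} → VSet G → VSet G → Set
_⊂_ {G} S D = (_⊆_ {G} S D) × (∃[ x ] (D x × ¬ S x))

MinimalDominating : (G : Graph) → VSet G → Set₁
MinimalDominating G D =
  Dominating G D × (∀ (S : VSet G) → _⊂_ {G} S D → ¬ Dominating G S)

Independent : (G : Graph) → VSet G → Set
Independent G D = ∀ {x y} → D x → D y → ¬ Adj G x y

open import Relation.Nullary.Decidable using (_×-dec_)
open import Data.Nat using (_*_)
open import Data.Fin using (combine; remQuot)
open import Data.Fin.Properties using (remQuot-combine; combine-remQuot)
open import Function.Bundles using (mk↔ₛ′)
open import Function.Properties.Inverse using (↔-trans)
open import Data.Product.Function.NonDependent.Propositional using (_×-↔_)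
open import Relation.Binary.PropositionalEquality using (refl; cong)

Fin×↔Fin* : (n m : ℕ) → (Fin n × Fin m) ↔ Fin (n * m)
Fin×↔Fin* n m = mk↔ₛ′ (λ p → combine (proj₁ p) (proj₂ p)) (remQuot m)
  (λ k → combine-remQuot {n} m k)
  (λ p → remQuot-combine (proj₁ p) (proj₂ p))

_⊗_ : Graph → Graph → Graph
G ⊗ H = record
  { V      = V G × V H
  ; order  = order G * order H
  ; enum   = ↔-trans (enum G ×-↔ enum H) (Fin×↔Fin* (order G) (order H))
  ; Adj    = λ p q → Adj G (proj₁ p) (proj₁ q) × Adj H (proj₂ p) (proj₂ q)
  ; Adj?   = λ p q → Adj? G (proj₁ p) (proj₁ q) ×-dec Adj? H (proj₂ p) (proj₂ q)
  ; sym    = λ a → sym G (proj₁ a) , sym H (proj₂ a)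
  ; irrefl = λ a → irrefl G (proj₁ a)
  }

_×V_ : {G : Graph} → VSet G → (H : Graph) → VSet (G ⊗ H)
(D ×V H) p = D (proj₁ p)

-- D × V(H) dominates because every vertex of H has a neighbour.  If D is independent then so
-- is D × V(H), and an independent set has no proper dominating subset: a removed vertex could
-- only be dominated by a neighbour inside the set.  Conversely, if d₁ ∼ d₂ in D, choose h ∈ V(H)
-- that is nobody's only neighbour (it exists because H is connected of order ≥ 3); then
-- D × V(H) ∖ {(d₁, h)} still dominates, (d₁, h) itself being dominated by some (d₂, k).
module Submission where

open import Defs
open import Data.Nat using (_≥_; s≤s; z≤n)
open import Data.Nat.Properties using (<⇒≤; ≤-trans)
open import Data.Fin using (Fin; zero; suc; punchIn; fromℕ<)
open import Data.Fin.Properties using (punchInᵢ≢i; suc-injective; any?; inj⇒≟)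
open import Data.Product using (_×_; _,_; ∃; proj₁; proj₂)
open import Data.Sum using (_⊎_; inj₁; inj₂)
open import Data.Empty using (⊥; ⊥-elim)
open import Function using (_∘_)
open import Function.Bundles using (_⇔_; mk⇔; Inverse)
open import Function.Properties.Inverse using (↔⇒↣)
open import Relation.Nullary using (¬_; Dec; yes; no; ¬?)
open import Relation.Nullary.Decidable using (map′; decidable-stable)
open import Relation.Unary using (Decidable)
open import Relation.Binary.Definitions using (DecidableEquality)
open import Relation.Binary.PropositionalEquality using (_≡_; _≢_; refl; cong; subst)
  renaming (sym to ≡-sym)

∃-≢ᶠ : ∀ {n} → n ≥ 2 → (i : Fin n) → ∃ (_≢ i)
∃-≢ᶠ (s≤s (s≤s _)) i = punchIn i zero , punchInᵢ≢i i zero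

∃-≢₂ᶠ : ∀ {n} → n ≥ 3 → (i j : Fin n) → ∃ λ k → k ≢ i × k ≢ j
∃-≢₂ᶠ (s≤s (s≤s (s≤s _))) zero    zero    = suc zero , (λ ()) , (λ ())
∃-≢₂ᶠ (s≤s (s≤s (s≤s _))) zero    (suc j) = suc (punchIn j zero) , (λ ()) , punchInᵢ≢i j zero ∘ suc-injective
∃-≢₂ᶠ (s≤s (s≤s (s≤s _))) (suc i) zero    = suc (punchIn i zero) , punchInᵢ≢i i zero ∘ suc-injective , (λ ())
∃-≢₂ᶠ (s≤s (s≤s (s≤s _))) (suc i) (suc j) = zero , (λ ()) , (λ ())

module _ (G : Graph) where

  OtherNeighbour : V G → V G → Set
  OtherNeighbour h k = ∃ λ z → Adj G k z × z ≢ h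

  -- Also holds when k is isolated.
  OnlyNeighbour : V G → V G → Set
  OnlyNeighbour h k = ∀ {z} → Adj G k z → z ≡ h

module FiniteGraph (G : Graph) where
  open Inverse (enum G)

  _≟_ : DecidableEquality (V G)
  _≟_ = inj⇒≟ (↔⇒↣ (enum G))

  ∃? : {P : V G → Set} → Decidable P → Dec (∃ P)
  ∃? {P} P? = map′ (λ (i , p) → from i , p)
                   (λ (x , p) → to x , subst P (≡-sym (inverseʳ refl)) p)
                   (any? (P? ∘ from))

  ∀-or-∃¬ : {P : V G → Set} → Decidable P → (∀ x → P x) ⊎ ∃ (¬_ ∘ P)
  ∀-or-∃¬ P? with ∃? (¬? ∘ P?)
  ... | yes counterexample = inj₂ counterexample
  ... | no  none           = inj₁ λ x → decidable-stable (P? x) (λ ¬px → none (x , ¬px))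

  from-≢ : ∀ {i x} → i ≢ to x → from i ≢ x
  from-≢ i≢ e = i≢ (≡-sym (inverseˡ (≡-sym e)))

  vertex : order G ≥ 1 → V G
  vertex ∣G∣≥1 = from (fromℕ< ∣G∣≥1)

  ∃-≢ : order G ≥ 2 → (x : V G) → ∃ (_≢ x)
  ∃-≢ ∣G∣≥2 x with ∃-≢ᶠ ∣G∣≥2 (to x)
  ... | i , i≢x = from i , from-≢ i≢x

  ∃-≢₂ : order G ≥ 3 → (x y : V G) → ∃ λ z → z ≢ x × z ≢ y
  ∃-≢₂ ∣G∣≥3 x y with ∃-≢₂ᶠ ∣G∣≥3 (to x) (to y)
  ... | i , i≢x , i≢y = from i , from-≢ i≢x , from-≢ i≢y

  otherNeighbour? : ∀ h k → Dec (OtherNeighbour G h k)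
  otherNeighbour? h k = ∃? λ z → adj-other z (Adj? G k z) (z ≟ h)
    where
    adj-other : ∀ z → Dec (Adj G k z) → Dec (z ≡ h) → Dec (Adj G k z × z ≢ h)
    adj-other z (yes a) (no  z≢h) = yes (a , z≢h)
    adj-other z (yes _) (yes z≡h) = no λ (_ , z≢h) → z≢h z≡h
    adj-other z (no ¬a) _         = no λ (a , _) → ¬a a

  ¬other⇒only : ∀ {h k} → ¬ OtherNeighbour G h k → OnlyNeighbour G h k
  ¬other⇒only {h} ¬other {z} a = decidable-stable (z ≟ h) λ z≢h → ¬other (z , a , z≢h)

walk-source-has-neighbour : ∀ {G x y} → Walk G x y → x ≢ y → ∃ (Adj G x)
walk-source-has-neighbour here       x≢x = ⊥-elim (x≢x refl)
walk-source-has-neighbour (step a _) _  = _ , a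

walk-from-closed-pair : ∀ {G h k x y} → OnlyNeighbour G k h → OnlyNeighbour G h k →
                        x ≡ h ⊎ x ≡ k → Walk G x y → y ≡ h ⊎ y ≡ k
walk-from-closed-pair h→k k→h x∈ here = x∈
walk-from-closed-pair h→k k→h (inj₁ refl) (step a w) = walk-from-closed-pair h→k k→h (inj₂ (h→k a)) w
walk-from-closed-pair h→k k→h (inj₂ refl) (step a w) = walk-from-closed-pair h→k k→h (inj₁ (k→h a)) w

module ConnectedGraph (G : Graph) (conn : Connected G) where
  open FiniteGraph G

  ∃-neighbour : order G ≥ 2 → ∀ x → ∃ (Adj G x)
  ∃-neighbour ∣G∣≥2 x with ∃-≢ ∣G∣≥2 x
  ... | y , y≢x = walk-source-has-neighbour (conn x y) (y≢x ∘ ≡-sym)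

  ¬closed-pair : order G ≥ 3 → ∀ {h k} → OnlyNeighbour G k h → OnlyNeighbour G h k → ⊥
  ¬closed-pair ∣G∣≥3 {h} {k} h→k k→h with ∃-≢₂ ∣G∣≥3 h k
  ... | z , z≢h , z≢k with walk-from-closed-pair h→k k→h (inj₁ refl) (conn h z)
  ...   | inj₁ z≡h = z≢h z≡h
  ...   | inj₂ z≡k = z≢k z≡k

  -- A vertex j whose only neighbour is k must be h₀, which would make {h₀, k} a component.
  leaf-is-nobodys-only-neighbour : order G ≥ 3 → ∀ {h₀ k} → OnlyNeighbour G h₀ k →
                                   ∀ j → OtherNeighbour G k j
  leaf-is-nobodys-only-neighbour ∣G∣≥3 {h₀} {k} k→h₀ j with otherNeighbour? k j
  ... | yes other = other
  ... | no ¬other = ⊥-elim (¬closed-pair ∣G∣≥3 h₀→k k→h₀)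
    where
    j→k : OnlyNeighbour G k j
    j→k = ¬other⇒only ¬other

    j∼k : Adj G j k
    j∼k with ∃-neighbour (<⇒≤ ∣G∣≥3) j
    ... | z , j∼z = subst (Adj G j) (j→k j∼z) j∼z

    h₀→k : OnlyNeighbour G k h₀
    h₀→k h₀∼z = j→k (subst (λ x → Adj G x _) (≡-sym (k→h₀ (sym G j∼k))) h₀∼z)

  ∃-not-only-neighbour : order G ≥ 3 → ∃ λ h → ∀ k → OtherNeighbour G h k
  ∃-not-only-neighbour ∣G∣≥3 with ∀-or-∃¬ (otherNeighbour? h₀)
    where h₀ = vertex (≤-trans (s≤s z≤n) ∣G∣≥3)
  ... | inj₁ everyOther     = _ , everyOther
  ... | inj₂ (k , ¬otherₖ) = k , leaf-is-nobodys-only-neighbour ∣G∣≥3 (¬other⇒only ¬otherₖ)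

×V-dominating : ∀ {G H} {D : VSet G} → (∀ k → ∃ (Adj H k)) → Dominating G D →
                Dominating (G ⊗ H) (_×V_ {G} D H)
×V-dominating {H = H} nbr dom (g , k) with dom g
... | inj₁ g∈D              = inj₁ g∈D
... | inj₂ (d , d∈D , g∼d) = inj₂ ((d , proj₁ (nbr k)) , d∈D , g∼d , proj₂ (nbr k))

×V-independent : ∀ {G H} {D : VSet G} → Independent G D → Independent (G ⊗ H) (_×V_ {G} D H)
×V-independent ind p∈ q∈ (a , _) = ind p∈ q∈ a

independent⇒no-proper-dominating-subset : ∀ {X} {D : VSet X} → Independent X D →
  ∀ (S : VSet X) → _⊂_ {X} S D → ¬ Dominating X S
independent⇒no-proper-dominating-subset ind S (S⊆D , x , x∈D , x∉S) domS with domS x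
... | inj₁ x∈S              = x∉S x∈S
... | inj₂ (y , y∈S , x∼y) = ind x∈D (S⊆D y∈S) x∼y

×V-minimal⇒independent : ∀ {G H} {D : VSet G} → (h : V H) → (∀ k → OtherNeighbour H h k) →
  Dominating G D → MinimalDominating (G ⊗ H) (_×V_ {G} D H) → Independent G D
×V-minimal⇒independent {G} {H} {D} h other domD (_ , minimal) {d₁} {d₂} d₁∈D d₂∈D d₁∼d₂ =
  minimal S ((λ (p∈D , _) → p∈D) , (d₁ , h) , d₁∈D , λ (_ , ≢) → ≢ refl) domS
  where
  open FiniteGraph (G ⊗ H) using (_≟_)

  S : VSet (G ⊗ H)
  S p = D (proj₁ p) × p ≢ (d₁ , h)

  domS : Dominating (G ⊗ H) S
  domS (g , k) with (g , k) ≟ (d₁ , h)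
  ... | yes refl with other h
  ...   | k′ , h∼k′ , k′≢h = inj₂ ((d₂ , k′) , (d₂∈D , k′≢h ∘ cong proj₂) , d₁∼d₂ , h∼k′)
  domS (g , k) | no ≢ with domD g
  ...   | inj₁ g∈D = inj₁ (g∈D , ≢)
  ...   | inj₂ (d , d∈D , g∼d) with other k
  ...     | k′ , k∼k′ , k′≢h = inj₂ ((d , k′) , (d∈D , k′≢h ∘ cong proj₂) , g∼d , k∼k′)

lemma3 : (G H : Graph) → Connected G → Connected H →
         order G ≥ 3 → order H ≥ 3 →
         (D : VSet G) → MinimalDominating G D →
         (MinimalDominating (G ⊗ H) (_×V_ {G} D H) ⇔ Independent G D)
lemma3 G H _ connH _ ∣H∣≥3 D (domD , _) =
  mk⇔ (×V-minimal⇒independent {G} {H} h other domD)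
      (λ ind → ×V-dominating {G} {H} neighbour domD ,
               independent⇒no-proper-dominating-subset {G ⊗ H} (×V-independent {G} {H} ind))
  where
  open ConnectedGraph H connH
  h : V H
  h = proj₁ (∃-not-only-neighbour ∣H∣≥3)

  other : ∀ k → OtherNeighbour H h k
  other = proj₂ (∃-not-only-neighbour ∣H∣≥3)

  neighbour : ∀ k → ∃ (Adj H k)
  neighbour k with other k
  ... | z , k∼z , _ = z , k∼z
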